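{- If $t\in U$ and $t\to^{*}_{\mathcal{H}\cup\mathrm{AC}}u$, then $u\in U$.
   Context: Terms are built from variables and: constants $\mathsf{h},\mathsf{0}$; unary $\mathsf{I},\mathsf{E},\mathsf{s}$; binary $\mathsf{A},\mathsf{B},\mathsf{C},\mathsf{D}$ and binary $\mid$ (infix). $\to_{\mathcal{H}\cup\mathrm{AC}}$ is the rewrite relation (closure under substitutions and contexts) of the rules of $\mathcal{H}$ together with the associativity and commutativity equations of $\mid$ used in both directions; $\to^*$ is reflexive transitive closure. The TRS $\mathcal{H}$: (1) $\mathsf{A}(n,\mathsf{I}(\mathsf{h}))\to\mathsf{A}(\mathsf{s}(n),\mathsf{h})$; (2) $\mathsf{A}(n,\mathsf{I}(\mathsf{h}\mid x))\to\mathsf{A}(\mathsf{s}(n),\mathsf{I}(x))$; (3) $\mathsf{A}(n,\mathsf{I}(x))\to\mathsf{B}(n,\mathsf{D}(\mathsf{s}(n),\mathsf{I}(x)))$; (4) $\mathsf{C}(\mathsf{0},x)\to\mathsf{E}(x)$; (5) $\mathsf{C}(\mathsf{s}(n),x)\to x\mid\mathsf{C}(n,x)$; (6) $\mathsf{I}(\mathsf{E}(x)\mid y)\to\mathsf{E}(\mathsf{I}(x\mid y))$; (7) $\mathsf{I}(\mathsf{E}(x))\to\mathsf{E}(\mathsf{I}(x))$; (8) $\mathsf{D}(n,\mathsf{I}(\mathsf{I}(x)))\to\mathsf{I}(\mathsf{D}(n,\mathsf{I}(x)))$; (9) $\mathsf{D}(n,\mathsf{I}(\mathsf{I}(x)\mid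 y))\to\mathsf{I}(\mathsf{D}(n,\mathsf{I}(x))\mid y)$; (10) $\mathsf{D}(n,\mathsf{I}(\mathsf{I}(\mathsf{h}\mid x)\mid y))\to\mathsf{I}(\mathsf{C}(n,\mathsf{I}(x))\mid y)$; (11) $\mathsf{D}(n,\mathsf{I}(\mathsf{I}(\mathsf{h}\mid x)))\to\mathsf{I}(\mathsf{C}(n,\mathsf{I}(x)))$; (12) $\mathsf{D}(n,\mathsf{I}(\mathsf{I}(\mathsf{h})\mid y))\to\mathsf{I}(\mathsf{C}(n,\mathsf{h})\mid y)$; (13) $\mathsf{D}(n,\mathsf{I}(\mathsf{I}(\mathsf{h})))\to\mathsf{I}(\mathsf{C}(n,\mathsf{h}))$; (14) $\mathsf{B}(n,\mathsf{E}(x))\to\mathsf{A}(\mathsf{s}(n),x)$. $\mathcal{T}_{\mathcal{H}}$ is the set of ground terms over $\{\mathsf{h},\mathsf{I},\mid\}$ and $\mathcal{C}_{\mathcal{H}}$ the set of ground contexts over $\{\mathsf{h},\mathsf{I},\mid\}$ (terms with exactly one occurrence of a hole $\Box$); $C[t]$ replaces the hole by $t$. Write $\overline{n}=\mathsf{s}^n(\mathsf{0})$. $U$ is the set of all terms of the forms $\mathsf{A}(\overline{n},t)$, $\mathsf{B}(\overline{n},C[\mathsf{C}(\overline{m},t)])$, $\mathsf{B}(\overline{n},C[\mathsf{D}(\overline{n+1},t)])$, $\mathsf{B}(\overline{n},C[\mathsf{E}(t)])$ with $n,m\in\mathbb{N}$, $t\in\mathcal{T}_{\mathcal{H}}$,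 $C\in\mathcal{C}_{\mathcal{H}}$. -}

module Defs where

open import Data.Nat using (ℕ; zero; suc)
open import Relation.Binary.Construct.Closure.ReflexiveTransitive using (Star)

infixr 6 _∣_

data Term : Set where
  var : ℕ → Term
  h Z : Term
  I E s : Term → Term
  A B C D : Term → Term → Term
  _∣_ : Term → Term → Term

-- Root steps list the rules of H with
-- arbitrary terms for their variables (= closure under substitution), and
-- the associativity/commutativity equations of ∣ in both directions;
-- the remaining constructors give closure under contexts.
data _⟶_ : Term → Term → Set where
  r1  : ∀ n → A n (I h) ⟶ A (s n) h
  r2  : ∀ n x → A n (I (h ∣ x)) ⟶ A (s n) (I x)
  r3  : ∀ n x → A n (I x) ⟶ B n (D (s n) (I x))
  r4  : ∀ x → C Z x ⟶ E x
  r5  : ∀ n x → C (s n) x ⟶ (x ∣ C n x)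
  r6  : ∀ x y → I (E x ∣ y) ⟶ E (I (x ∣ y))
  r7  : ∀ x → I (E x) ⟶ E (I x)
  r8  : ∀ n x → D n (I (I x)) ⟶ I (D n (I x))
  r9  : ∀ n x y → D n (I (I x ∣ y)) ⟶ I (D n (I x) ∣ y)
  r10 : ∀ n x y → D n (I (I (h ∣ x) ∣ y)) ⟶ I (C n (I x) ∣ y)
  r11 : ∀ n x → D n (I (I (h ∣ x))) ⟶ I (C n (I x))
  r12 : ∀ n y → D n (I (I h ∣ y)) ⟶ I (C n h ∣ y)
  r13 : ∀ n → D n (I (I h)) ⟶ I (C n h)
  r14 : ∀ n x → B n (E x) ⟶ A (s n) x
  assoc→ : ∀ x y z → ((x ∣ y) ∣ z) ⟶ (x ∣ (y ∣ z))
  assoc← : ∀ x y z → (x ∣ (y ∣ z)) ⟶ ((x ∣ y) ∣ z)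
  comm   : ∀ x y → (x ∣ y) ⟶ (y ∣ x)
  cI  : ∀ {x x'} → x ⟶ x' → I x ⟶ I x'
  cE  : ∀ {x x'} → x ⟶ x' → E x ⟶ E x'
  cs  : ∀ {x x'} → x ⟶ x' → s x ⟶ s x'
  cA₁ : ∀ {x x' y} → x ⟶ x' → A x y ⟶ A x' y
  cA₂ : ∀ {x y y'} → y ⟶ y' → A x y ⟶ A x y'
  cB₁ : ∀ {x x' y} → x ⟶ x' → B x y ⟶ B x' y
  cB₂ : ∀ {x y y'} → y ⟶ y' → B x y ⟶ B x y'
  cC₁ : ∀ {x x' y} → x ⟶ x' → C x y ⟶ C x' y
  cC₂ : ∀ {x y y'} → y ⟶ y' → C x y ⟶ C x y'
  cD₁ : ∀ {x x' y} → x ⟶ x' → D x y ⟶ D x' y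
  cD₂ : ∀ {x y y'} → y ⟶ y' → D x y ⟶ D x y'
  c∣₁ : ∀ {x x' y} → x ⟶ x' → (x ∣ y) ⟶ (x' ∣ y)
  c∣₂ : ∀ {x y y'} → y ⟶ y' → (x ∣ y) ⟶ (x ∣ y')

_⟶*_ : Term → Term → Set
_⟶*_ = Star _⟶_

data HT : Set where
  hH : HT
  IH : HT → HT
  _∣H_ : HT → HT → HT

⌜_⌝ : HT → Term
⌜ hH ⌝ = h
⌜ IH t ⌝ = I ⌜ t ⌝
⌜ t ∣H u ⌝ = ⌜ t ⌝ ∣ ⌜ u ⌝

data HCtx : Set where
  □ : HCtx
  IC : HCtx → HCtx
  _∣Cˡ_ : HCtx → HT → HCtx
  _∣Cʳ_ : HT → HCtx → HCtx

plug : HCtx → Term → Term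
plug □ t = t
plug (IC c) t = I (plug c t)
plug (c ∣Cˡ u) t = plug c t ∣ ⌜ u ⌝
plug (u ∣Cʳ c) t = ⌜ u ⌝ ∣ plug c t

num : ℕ → Term
num zero = Z
num (suc n) = s (num n)

data InU : Term → Set where
  uA : ∀ n (t : HT) → InU (A (num n) ⌜ t ⌝)
  uC : ∀ n m (c : HCtx) (t : HT) → InU (B (num n) (plug c (C (num m) ⌜ t ⌝)))
  uD : ∀ n (c : HCtx) (t : HT) → InU (B (num n) (plug c (D (num (suc n)) ⌜ t ⌝)))
  uE : ∀ n (c : HCtx) (t : HT) → InU (B (num n) (plug c (E ⌜ t ⌝)))

{-# OPTIONS --safe #-}
-- Numerals are normal forms, and ground terms over {h, I, ∣} are closed under
-- the steps that apply to them (only AC does).  Below B(n, _) the distinguished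
-- subterm X = C(m,t), D(n+1,t) or E(t) sits in an H-context, and every step
-- keeps this shape: C counts down to E, extending the context (rules 4, 5);
-- D descends through I (rules 8, 9) until rules 10–13 turn it into C(n+1, _);
-- E climbs through I (rules 6, 7); AC only rearranges the context.
-- Rules 3 and 14 pass between the A- and B-forms.
module Submission where

open import Defs
open import Data.Nat using (zero; suc)
open import Data.Empty using (⊥-elim)
open import Data.Product using (∃; ∃₂; _,_; _×_)
open import Relation.Nullary using (¬_)
open import Relation.Binary.Definitions using (_Respects_)
open import Relation.Binary.PropositionalEquality using (_≡_; refl)
open import Relation.Binary.Construct.Closure.ReflexiveTransitive using (ε; _◅_)

Respects-⟶* : {P : Term → Set} → P Respects _⟶_ → P Respects _⟶*_
Respects-⟶* resp ε p = p
Respects-⟶* resp (st ◅ r) p = Respects-⟶* resp r (resp st p)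

data IsNum : Term → Set where
  Z : IsNum Z
  s : ∀ {n} → IsNum n → IsNum (s n)

IsNum-irreducible : ∀ {n u} → IsNum n → ¬ (n ⟶ u)
IsNum-irreducible (s p) (cs st) = IsNum-irreducible p st

data IsHTerm : Term → Set where
  h : IsHTerm h
  I : ∀ {x} → IsHTerm x → IsHTerm (I x)
  _∣_ : ∀ {x y} → IsHTerm x → IsHTerm y → IsHTerm (x ∣ y)

IsHTerm-respects-⟶ : IsHTerm Respects _⟶_
IsHTerm-respects-⟶ (r6 x y) (I (() ∣ _))
IsHTerm-respects-⟶ (assoc→ x y z) ((a ∣ b) ∣ c) = a ∣ (b ∣ c)
IsHTerm-respects-⟶ (assoc← x y z) (a ∣ (b ∣ c)) = (a ∣ b) ∣ c
IsHTerm-respects-⟶ (comm x y) (a ∣ b) = b ∣ a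
IsHTerm-respects-⟶ (cI st) (I a) = I (IsHTerm-respects-⟶ st a)
IsHTerm-respects-⟶ (c∣₁ st) (a ∣ b) = IsHTerm-respects-⟶ st a ∣ b
IsHTerm-respects-⟶ (c∣₂ st) (a ∣ b) = a ∣ IsHTerm-respects-⟶ st b

data Filler (n : Term) : Term → Set where
  C : ∀ {m t} → IsNum m → IsHTerm t → Filler n (C m t)
  D : ∀ {t} → IsHTerm t → Filler n (D (s n) t)
  E : ∀ {t} → IsHTerm t → Filler n (E t)

data InHContext (n : Term) : Term → Set where
  □ : ∀ {t} → Filler n t → InHContext n t
  I : ∀ {t} → InHContext n t → InHContext n (I t)
  _∣ˡ_ : ∀ {t u} → InHContext n t → IsHTerm u → InHContext n (t ∣ u)
  _∣ʳ_ : ∀ {t u} → IsHTerm u → InHContext n t → InHContext n (u ∣ t)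

-- U with the images of num, ⌜_⌝ and plug described by predicates on terms,
-- so that a step out of an element can be analysed by matching on the step.
data InU′ : Term → Set where
  A : ∀ {n t} → IsNum n → IsHTerm t → InU′ (A n t)
  B : ∀ {n t} → IsNum n → InHContext n t → InU′ (B n t)

Filler-step : ∀ {n t u} → IsNum n → t ⟶ u → Filler n t → InHContext n u
Filler-step nn (r4 x) (C Z ht) = □ (E ht)
Filler-step nn (r5 m x) (C (s nm) ht) = ht ∣ʳ □ (C nm ht)
Filler-step nn (cC₁ st) (C nm ht) = ⊥-elim (IsNum-irreducible nm st)
Filler-step nn (cC₂ st) (C nm ht) = □ (C nm (IsHTerm-respects-⟶ st ht))
Filler-step nn (r8 n x) (D (I (I a))) = I (□ (D (I a)))
Filler-step nn (r9 n x y) (D (I (I a ∣ b))) = I (□ (D (I a)) ∣ˡ b)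
Filler-step nn (r10 n x y) (D (I (I (_ ∣ a) ∣ b))) = I (□ (C (s nn) (I a)) ∣ˡ b)
Filler-step nn (r11 n x) (D (I (I (_ ∣ a)))) = I (□ (C (s nn) (I a)))
Filler-step nn (r12 n y) (D (I (I _ ∣ b))) = I (□ (C (s nn) h) ∣ˡ b)
Filler-step nn (r13 n) (D (I (I _))) = I (□ (C (s nn) h))
Filler-step nn (cD₁ st) (D ht) = ⊥-elim (IsNum-irreducible (s nn) st)
Filler-step nn (cD₂ st) (D ht) = □ (D (IsHTerm-respects-⟶ st ht))
Filler-step nn (cE st) (E ht) = □ (E (IsHTerm-respects-⟶ st ht))

InHContext-respects-⟶ : ∀ {n} → IsNum n → InHContext n Respects _⟶_
InHContext-respects-⟶ nn st (□ f) = Filler-step nn st f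
InHContext-respects-⟶ nn (r6 x y) (I (□ (E a) ∣ˡ b)) = □ (E (I (a ∣ b)))
InHContext-respects-⟶ nn (r6 x y) (I (() ∣ʳ _))
InHContext-respects-⟶ nn (r7 x) (I (□ (E a))) = □ (E (I a))
InHContext-respects-⟶ nn (cI st) (I c) = I (InHContext-respects-⟶ nn st c)
InHContext-respects-⟶ nn (assoc→ x y z) (□ () ∣ˡ _)
InHContext-respects-⟶ nn (assoc→ x y z) ((c ∣ˡ b) ∣ˡ u) = c ∣ˡ (b ∣ u)
InHContext-respects-⟶ nn (assoc→ x y z) ((a ∣ʳ c) ∣ˡ u) = a ∣ʳ (c ∣ˡ u)
InHContext-respects-⟶ nn (assoc→ x y z) ((a ∣ b) ∣ʳ c) = a ∣ʳ (b ∣ʳ c)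
InHContext-respects-⟶ nn (assoc← x y z) (c ∣ˡ (b ∣ d)) = (c ∣ˡ b) ∣ˡ d
InHContext-respects-⟶ nn (assoc← x y z) (a ∣ʳ □ ())
InHContext-respects-⟶ nn (assoc← x y z) (a ∣ʳ (c ∣ˡ b)) = (a ∣ʳ c) ∣ˡ b
InHContext-respects-⟶ nn (assoc← x y z) (a ∣ʳ (b ∣ʳ c)) = (a ∣ b) ∣ʳ c
InHContext-respects-⟶ nn (comm x y) (c ∣ˡ u) = u ∣ʳ c
InHContext-respects-⟶ nn (comm x y) (u ∣ʳ c) = c ∣ˡ u
InHContext-respects-⟶ nn (c∣₁ st) (c ∣ˡ u) = InHContext-respects-⟶ nn st c ∣ˡ u
InHContext-respects-⟶ nn (c∣₂ st) (c ∣ˡ u) = c ∣ˡ IsHTerm-respects-⟶ st u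
InHContext-respects-⟶ nn (c∣₁ st) (u ∣ʳ c) = IsHTerm-respects-⟶ st u ∣ʳ c
InHContext-respects-⟶ nn (c∣₂ st) (u ∣ʳ c) = u ∣ʳ InHContext-respects-⟶ nn st c

InU′-respects-⟶ : InU′ Respects _⟶_
InU′-respects-⟶ (r1 n) (A nn _) = A (s nn) h
InU′-respects-⟶ (r2 n x) (A nn (I (_ ∣ a))) = A (s nn) (I a)
InU′-respects-⟶ (r3 n x) (A nn ht) = B nn (□ (D ht))
InU′-respects-⟶ (cA₁ st) (A nn _) = ⊥-elim (IsNum-irreducible nn st)
InU′-respects-⟶ (cA₂ st) (A nn ht) = A nn (IsHTerm-respects-⟶ st ht)
InU′-respects-⟶ (r14 n x) (B nn (□ (E a))) = A (s nn) a
InU′-respects-⟶ (cB₁ st) (B nn _) = ⊥-elim (IsNum-irreducible nn st)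
InU′-respects-⟶ (cB₂ st) (B nn c) = B nn (InHContext-respects-⟶ nn st c)

IsNum-num : ∀ k → IsNum (num k)
IsNum-num zero = Z
IsNum-num (suc k) = s (IsNum-num k)

IsNum⇒num : ∀ {n} → IsNum n → ∃ λ k → num k ≡ n
IsNum⇒num Z = zero , refl
IsNum⇒num (s p) with IsNum⇒num p
... | k , refl = suc k , refl

IsHTerm-⌜⌝ : ∀ t → IsHTerm ⌜ t ⌝
IsHTerm-⌜⌝ hH = h
IsHTerm-⌜⌝ (IH t) = I (IsHTerm-⌜⌝ t)
IsHTerm-⌜⌝ (t ∣H u) = IsHTerm-⌜⌝ t ∣ IsHTerm-⌜⌝ u

IsHTerm⇒⌜⌝ : ∀ {t} → IsHTerm t → ∃ λ u → ⌜ u ⌝ ≡ t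
IsHTerm⇒⌜⌝ h = hH , refl
IsHTerm⇒⌜⌝ (I p) with IsHTerm⇒⌜⌝ p
... | u , refl = IH u , refl
IsHTerm⇒⌜⌝ (p ∣ q) with IsHTerm⇒⌜⌝ p | IsHTerm⇒⌜⌝ q
... | u , refl | v , refl = u ∣H v , refl

InHContext-plug : ∀ {n X} (c : HCtx) → Filler n X → InHContext n (plug c X)
InHContext-plug □ f = □ f
InHContext-plug (IC c) f = I (InHContext-plug c f)
InHContext-plug (c ∣Cˡ u) f = InHContext-plug c f ∣ˡ IsHTerm-⌜⌝ u
InHContext-plug (u ∣Cʳ c) f = IsHTerm-⌜⌝ u ∣ʳ InHContext-plug c f

InHContext⇒plug : ∀ {n t} → InHContext n t → ∃₂ λ c X → Filler n X × plug c X ≡ t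
InHContext⇒plug (□ f) = □ , _ , f , refl
InHContext⇒plug (I p) with InHContext⇒plug p
... | c , X , f , refl = IC c , X , f , refl
InHContext⇒plug (p ∣ˡ q) with InHContext⇒plug p | IsHTerm⇒⌜⌝ q
... | c , X , f , refl | u , refl = c ∣Cˡ u , X , f , refl
InHContext⇒plug (q ∣ʳ p) with InHContext⇒plug p | IsHTerm⇒⌜⌝ q
... | c , X , f , refl | u , refl = u ∣Cʳ c , X , f , refl

InU⇒InU′ : ∀ {t} → InU t → InU′ t
InU⇒InU′ (uA n t) = A (IsNum-num n) (IsHTerm-⌜⌝ t)
InU⇒InU′ (uC n m c t) = B (IsNum-num n) (InHContext-plug c (C (IsNum-num m) (IsHTerm-⌜⌝ t)))
InU⇒InU′ (uD n c t) = B (IsNum-num n) (InHContext-plug c (D (IsHTerm-⌜⌝ t)))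
InU⇒InU′ (uE n c t) = B (IsNum-num n) (InHContext-plug c (E (IsHTerm-⌜⌝ t)))

InU′⇒InU : ∀ {t} → InU′ t → InU t
InU′⇒InU (A nn ht) with IsNum⇒num nn | IsHTerm⇒⌜⌝ ht
... | k , refl | t , refl = uA k t
InU′⇒InU (B nn p) with IsNum⇒num nn | InHContext⇒plug p
... | k , refl | c , _ , C nm ht , refl with IsNum⇒num nm | IsHTerm⇒⌜⌝ ht
...   | m , refl | t , refl = uC k m c t
InU′⇒InU (B nn p) | k , refl | c , _ , D ht , refl with IsHTerm⇒⌜⌝ ht
...   | t , refl = uD k c t
InU′⇒InU (B nn p) | k , refl | c , _ , E ht , refl with IsHTerm⇒⌜⌝ ht
...   | t , refl = uE k c t

lemma3p13 : (t u : Term) → InU t → t ⟶* u → InU u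
lemma3p13 t u t∈U t⟶*u = InU′⇒InU (Respects-⟶* InU′-respects-⟶ t⟶*u (InU⇒InU′ t∈U))
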